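{- For each $x\in\{\Box,\Diamond,\blacksquare,\bullet\}$, in the canonical model for $\mathbf{L}_x$ we have, for every formula $\gamma$ and every $w\in W$: $w\Vdash\gamma$ iff $\gamma\in w$.
   Context: For $x\in\{\Box,\Diamond,\blacksquare,\bullet\}$, the $x$-language has formulas built from a countable set $PV$ of propositional variables and $\bot$ by $\land,\lor,\rightarrow$ and the unary modal operator $x$; $\lnot\varphi$ abbreviates $\varphi\to\bot$, $\varphi\leftrightarrow\psi$ abbreviates $(\varphi\to\psi)\land(\psi\to\varphi)$. $\mathbf{L}_x$ is the smallest set of formulas containing all instances of the axiom schemes of intuitionistic propositional logic and all instances of $x\varphi\to\varphi$, closed under modus ponens and the rule: from $\varphi\leftrightarrow\psi$ infer $x\varphi\leftrightarrow x\psi$. A prime theory of $\mathbf{L}_x$ is a set $w$ of formulas with $\mathbf{L}_x\subseteq w$, closed under modus ponens, $\bot\notin w$, and $\varphi\lor\psi\in w$ implies $\varphi\in w$ or $\psi\in w$. The canonical model for $\mathbf{L}_x$ is $\langle W,\mathcal{N},\leq,V\rangle$ with $W$ the set of prime theories of $\mathbf{L}_x$, $w\leq v$ iff $w\subseteq v$, $V(q)=\{w:q\in w\}$, $\widehat{\varphi}=\{z\in W:\varphi\in z\}$, $-X=W\setminus X$, and: (for $\Box$) $\mathcal{N}_w=\{\widehat{\varphi}:\Box\varphi\in w\}$; (for $\Diamond$) $\mathcal{N}_w=\{W\setminus\widehat{\varphi}:\Diamond\varphi\notin w\}$; (for $\blacksquare$) $\mathcal{N}_w=\{W\setminus\widehat{\varphi}:\blacksquare\varphi\in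 w\}$; (for $\bullet$) $\mathcal{N}_w=\{\widehat{\varphi}:\bullet\varphi\notin w\}$. Forcing: $w\nVdash\bot$; $w\Vdash q$ iff $w\in V(q)$; $\land,\lor$ pointwise; $w\Vdash\varphi\to\psi$ iff for all $v\geq w$, $v\nVdash\varphi$ or $v\Vdash\psi$; with $V(\varphi)=\{z:z\Vdash\varphi\}$: $w\Vdash\Box\varphi$ iff $w\Vdash\varphi$ and $V(\varphi)\in\mathcal{N}_w$; $w\Vdash\Diamond\varphi$ iff $w\Vdash\varphi$ and $-V(\varphi)\notin\mathcal{N}_w$; $w\Vdash\blacksquare\varphi$ iff $w\Vdash\varphi$ and $-V(\varphi)\in\mathcal{N}_w$; $w\Vdash\bullet\varphi$ iff $w\Vdash\varphi$ and $V(\varphi)\notin\mathcal{N}_w$. -}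

module Defs where

import Level
open import Level using (Level; 0ℓ) renaming (suc to lsuc)
open import Data.Nat using (ℕ)
open import Data.Product using (Σ; _×_; _,_)
open import Data.Sum using (_⊎_)
open import Data.Empty using (⊥)
open import Relation.Nullary using (¬_)
open import Relation.Unary using (Pred; _≐_; _∈_; _∉_)

data Op : Set where
  box dia bbox bullet : Op

-- Formulas of the x-language: propositional variables (indexed by ℕ),
-- ⊥, ∧, ∨, → and a single unary modal operator `M`, read as x.

infixr 6 _∧'_
infixr 5 _∨'_
infixr 4 _⇒_

data Form : Set where
  var  : ℕ → Form
  ⊥'   : Form
  _∧'_ : Form → Form → Form
  _∨'_ : Form → Form → Form
  _⇒_  : Form → Form → Form
  M    : Form → Form

_⇔'_ : Form → Form → Form
φ ⇔' ψ = (φ ⇒ ψ) ∧' (ψ ⇒ φ)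

-- The logic L_x: smallest set containing the IPC axiom schemes and
-- x φ → φ, closed under modus ponens and  φ↔ψ / xφ↔xψ.
-- (The operator x only affects which model clauses are used; the
-- logic L_x is syntactically the same for every x.)

data Thm (x : Op) : Form → Set where
  ax-K   : ∀ {φ ψ}   → Thm x (φ ⇒ ψ ⇒ φ)
  ax-S   : ∀ {φ ψ χ} → Thm x ((φ ⇒ ψ ⇒ χ) ⇒ (φ ⇒ ψ) ⇒ φ ⇒ χ)
  ax-∧E₁ : ∀ {φ ψ}   → Thm x (φ ∧' ψ ⇒ φ)
  ax-∧E₂ : ∀ {φ ψ}   → Thm x (φ ∧' ψ ⇒ ψ)
  ax-∧I  : ∀ {φ ψ}   → Thm x (φ ⇒ ψ ⇒ φ ∧' ψ)
  ax-∨I₁ : ∀ {φ ψ}   → Thm x (φ ⇒ φ ∨' ψ)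
  ax-∨I₂ : ∀ {φ ψ}   → Thm x (ψ ⇒ φ ∨' ψ)
  ax-∨E  : ∀ {φ ψ χ} → Thm x ((φ ⇒ χ) ⇒ (ψ ⇒ χ) ⇒ φ ∨' ψ ⇒ χ)
  ax-⊥E  : ∀ {φ}     → Thm x (⊥' ⇒ φ)
  ax-T   : ∀ {φ}     → Thm x (M φ ⇒ φ)
  mp     : ∀ {φ ψ}   → Thm x (φ ⇒ ψ) → Thm x φ → Thm x ψ
  cong-M : ∀ {φ ψ}   → Thm x (φ ⇔' ψ) → Thm x (M φ ⇔' M ψ)

record PrimeTheory (x : Op) : Set₁ where
  field
    mem        : Pred Form 0ℓ
    has-L      : ∀ {φ} → Thm x φ → mem φ
    closed-mp  : ∀ {φ ψ} → mem (φ ⇒ ψ) → mem φ → mem ψ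
    consistent : ¬ mem ⊥'
    prime      : ∀ {φ ψ} → mem (φ ∨' ψ) → mem φ ⊎ mem ψ
open PrimeTheory public

record NModel : Set₂ where
  field
    W   : Set₁
    N   : W → Pred (Pred W (lsuc 0ℓ)) (lsuc 0ℓ)
    _≤_ : W → W → Set₁
    V   : ℕ → Pred W (lsuc 0ℓ)

-_ : ∀ {A : Set₁} → Pred A (lsuc 0ℓ) → Pred A (lsuc 0ℓ)
(- X) z = ¬ X z

-- Modal forcing clause for x, given
--   here   = "w ⊩ φ",
--   inN    = "V(φ) ∈ N_w",
--   coInN  = "-V(φ) ∈ N_w".
modalClause : Op → Set₁ → Set₁ → Set₁ → Set₁
modalClause box    here inN coInN = here × inN
modalClause dia    here inN coInN = here × ¬ coInN
modalClause bbox   here inN coInN = here × coInN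
modalClause bullet here inN coInN = here × ¬ inN

module Forcing (x : Op) (𝔐 : NModel) where
  open NModel 𝔐

  infix 3 _⊩_
  _⊩_ : W → Form → Set₁
  w ⊩ var q    = V q w
  w ⊩ ⊥'       = Level.Lift (lsuc 0ℓ) ⊥
  w ⊩ (φ ∧' ψ) = (w ⊩ φ) × (w ⊩ ψ)
  w ⊩ (φ ∨' ψ) = (w ⊩ φ) ⊎ (w ⊩ ψ)
  w ⊩ (φ ⇒ ψ)  = ∀ v → w ≤ v → ¬ (v ⊩ φ) ⊎ (v ⊩ ψ)
  w ⊩ M φ      = modalClause x (w ⊩ φ) ((λ z → z ⊩ φ) ∈ N w)
                                        ((- (λ z → z ⊩ φ)) ∈ N w)

hat : ∀ {x} → Form → Pred (PrimeTheory x) 0ℓ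
hat φ z = mem z φ

cohat : ∀ {x} → Form → Pred (PrimeTheory x) 0ℓ
cohat φ z = ¬ mem z φ

Nc : (x : Op) → PrimeTheory x → Pred (Pred (PrimeTheory x) (lsuc 0ℓ)) (lsuc 0ℓ)
Nc box    w X = Σ Form λ φ → (X ≐ hat φ)   × mem w (M φ)
Nc dia    w X = Σ Form λ φ → (X ≐ cohat φ) × ¬ mem w (M φ)
Nc bbox   w X = Σ Form λ φ → (X ≐ cohat φ) × mem w (M φ)
Nc bullet w X = Σ Form λ φ → (X ≐ hat φ)   × ¬ mem w (M φ)

canonical : Op → NModel
canonical x = record
  { W   = PrimeTheory x
  ; N   = Nc x
  ; _≤_ = λ w v → Level.Lift (lsuc 0ℓ) (∀ {φ} → mem w φ → mem v φ)
  ; V   = λ q w → Level.Lift (lsuc 0ℓ) (mem w (var q))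
  }

{-# OPTIONS --safe #-}
module Submission where

-- Prime extension: if ψ is not derivable from the premises T together with φ, then
-- T ∪ {φ} extends to a prime theory omitting ψ.  Enumerate all formulas and add each
-- one to a growing finite set of premises unless that makes ψ derivable (excluded
-- middle decides this).  Every formula is eventually either derivable or such that
-- adding it derives ψ, which makes the limit prime.  This gives the implication case,
-- and it shows that φ̂ = ψ̂ implies ⊢ φ ↔ ψ, so by the congruence rule xφ ∈ w iff xψ ∈ w.
--
-- Modal case: by induction V(φ) = φ̂.  A canonical neighbourhood is a set equal to some
-- ψ̂ (or its complement) subject to a condition on xψ ∈ w, and by the previous remark
-- that condition depends only on the set; so V(φ) ∈ N_w, resp. −V(φ) ∈ N_w, reduces to
-- a condition on xφ ∈ w, and the axiom xφ → φ absorbs the conjunct w ⊩ φ.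

open import Defs
open import Level using (0ℓ; lift; lower) renaming (suc to lsuc)
open import Axiom.ExcludedMiddle using (ExcludedMiddle)
open import Axiom.DoubleNegationElimination using (DoubleNegationElimination; em⇒dne)
open import Function.Base using (_∘_; id)
open import Function.Bundles using (_⇔_; mk⇔; Equivalence)
open import Function.Construct.Composition using (_⇔-∘_)
open import Function.Construct.Symmetry using (⇔-sym)
open import Data.Nat using (ℕ; zero; suc; _≤_; _≤′_; ≤′-refl; ≤′-step; _⊔_)
open import Data.Nat.Properties using (≤⇒≤′; m≤m⊔n; m≤n⊔m; ≤-trans)
open import Data.List using (List; []; _∷_; _++_; map; concatMap; foldl; cartesianProductWith)
open import Data.List.Membership.Propositional using (_∈_)
open import Data.List.Membership.Propositional.Properties
  using (∈-++⁺ˡ; ∈-++⁺ʳ; ∈-map⁺; ∈-concatMap⁺; ∈-cartesianProductWith⁺)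
open import Data.List.Relation.Unary.Any using (here; there)
import Data.List.Relation.Unary.Any as Any
open import Data.List.Relation.Binary.Subset.Propositional using (_⊆_)
open import Data.List.Relation.Binary.Subset.Propositional.Properties
  using (⊆-refl; ⊆-trans; xs⊆x∷xs; ∷⁺ʳ)
open import Data.Product using (Σ; _×_; _,_; proj₂)
open import Data.Product.Function.NonDependent.Propositional using (_×-⇔_)
open import Data.Sum using (_⊎_; inj₁; inj₂; [_,_])
open import Data.Sum.Function.Propositional using (_⊎-⇔_)
open import Data.Empty using (⊥-elim)
open import Relation.Nullary using (¬_; yes; no)
open import Relation.Nullary.Decidable using (map′)
open import Relation.Unary using (Pred; _≐_) renaming (_⊆_ to _⊆ᵖ_)
open import Relation.Unary.Properties using (≐-sym; ≐-trans)
open import Relation.Binary.PropositionalEquality using (_≡_; refl)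

open Equivalence using (to; from)

private
  variable
    φ ψ χ : Form
    Γ Δ : List Form
    n m : ℕ

binaryConnectives : List (Form → Form → Form)
binaryConnectives = _∧'_ ∷ _∨'_ ∷ _⇒_ ∷ []

formulasUpTo : ℕ → List Form
formulasUpTo zero    = ⊥' ∷ []
formulasUpTo (suc n) =
  var n ∷ Φ ++ map M Φ ++ concatMap (λ c → cartesianProductWith c Φ Φ) binaryConnectives
  where Φ = formulasUpTo n

formulasUpTo-mono : n ≤ m → formulasUpTo n ⊆ formulasUpTo m
formulasUpTo-mono = mono′ ∘ ≤⇒≤′
  where
    mono′ : n ≤′ m → formulasUpTo n ⊆ formulasUpTo m
    mono′ ≤′-refl        p = p
    mono′ (≤′-step n≤′m) p = there (∈-++⁺ˡ (mono′ n≤′m p))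

Enumerated : Form → Set
Enumerated φ = Σ ℕ λ n → φ ∈ formulasUpTo n

M-enumerated : Enumerated φ → Enumerated (M φ)
M-enumerated (n , p) = suc n , there (∈-++⁺ʳ (formulasUpTo n) (∈-++⁺ˡ (∈-map⁺ M p)))

binary-enumerated : ∀ {c} → c ∈ binaryConnectives →
                    Enumerated φ → Enumerated ψ → Enumerated (c φ ψ)
binary-enumerated {φ} {ψ} c∈ (n , p) (m , q) =
  suc (n ⊔ m) , there (∈-++⁺ʳ Φ (∈-++⁺ʳ (map M Φ) (∈-concatMap⁺ pairs (Any.map c-pairs c∈))))
  where
    Φ = formulasUpTo (n ⊔ m)
    pairs : (Form → Form → Form) → List Form
    pairs c = cartesianProductWith c Φ Φ
    c-pairs : ∀ {c c′} → c ≡ c′ → c φ ψ ∈ pairs c′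
    c-pairs refl = ∈-cartesianProductWith⁺ _
      (formulasUpTo-mono (m≤m⊔n n m) p) (formulasUpTo-mono (m≤n⊔m n m) q)

enumerate : (φ : Form) → Enumerated φ
enumerate (var q)  = suc q , here refl
enumerate ⊥'       = zero , here refl
enumerate (φ ∧' ψ) = binary-enumerated (here refl) (enumerate φ) (enumerate ψ)
enumerate (φ ∨' ψ) = binary-enumerated (there (here refl)) (enumerate φ) (enumerate ψ)
enumerate (φ ⇒ ψ)  = binary-enumerated (there (there (here refl))) (enumerate φ) (enumerate ψ)
enumerate (M φ)    = M-enumerated (enumerate φ)

⇒-refl : ∀ {x} → Thm x (φ ⇒ φ)
⇒-refl {φ = φ} = mp (mp (ax-S {ψ = φ ⇒ φ}) ax-K) ax-K

module Derivation (x : Op) (T : Pred Form 0ℓ) where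

  infix 2 _⊢_
  data _⊢_ (Γ : List Form) : Form → Set where
    premise    : T φ → Γ ⊢ φ
    axiom      : Thm x φ → Γ ⊢ φ
    assumption : φ ∈ Γ → Γ ⊢ φ
    ⇒-elim     : Γ ⊢ φ ⇒ ψ → Γ ⊢ φ → Γ ⊢ ψ

  weaken : Γ ⊆ Δ → Γ ⊢ φ → Δ ⊢ φ
  weaken Γ⊆Δ (premise t)    = premise t
  weaken Γ⊆Δ (axiom t)      = axiom t
  weaken Γ⊆Δ (assumption p) = assumption (Γ⊆Δ p)
  weaken Γ⊆Δ (⇒-elim d e)   = ⇒-elim (weaken Γ⊆Δ d) (weaken Γ⊆Δ e)

  ⇒-intro : φ ∷ Γ ⊢ ψ → Γ ⊢ φ ⇒ ψ
  ⇒-intro (premise t)              = ⇒-elim (axiom ax-K) (premise t)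
  ⇒-intro (axiom t)                = ⇒-elim (axiom ax-K) (axiom t)
  ⇒-intro (assumption (here refl)) = axiom ⇒-refl
  ⇒-intro (assumption (there p))   = ⇒-elim (axiom ax-K) (assumption p)
  ⇒-intro (⇒-elim d e)             = ⇒-elim (⇒-elim (axiom ax-S) (⇒-intro d)) (⇒-intro e)

  ∨-elim : Γ ⊢ φ ∨' ψ → φ ∷ Γ ⊢ χ → ψ ∷ Γ ⊢ χ → Γ ⊢ χ
  ∨-elim d e f = ⇒-elim (⇒-elim (⇒-elim (axiom ax-∨E) (⇒-intro e)) (⇒-intro f)) d

  ⊢-closed : (∀ {φ} → Thm x φ → T φ) → (∀ {φ ψ} → T (φ ⇒ ψ) → T φ → T ψ) →
             [] ⊢ φ → T φ
  ⊢-closed has-L closed-mp (premise t)  = t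
  ⊢-closed has-L closed-mp (axiom t)    = has-L t
  ⊢-closed has-L closed-mp (⇒-elim d e) =
    closed-mp (⊢-closed has-L closed-mp d) (⊢-closed has-L closed-mp e)

module PrimeExtension (lem₀ : ExcludedMiddle 0ℓ) (x : Op) (T : Pred Form 0ℓ)
                      (φ ψ : Form) (φ⊬ψ : ¬ Derivation._⊢_ x T (φ ∷ []) ψ) where
  open Derivation x T

  extend : List Form → Form → List Form
  extend Γ f with lem₀ {f ∷ Γ ⊢ ψ}
  ... | yes _ = Γ
  ... | no  _ = f ∷ Γ

  stage : ℕ → List Form
  stage zero    = φ ∷ []
  stage (suc n) = foldl extend (stage n) (formulasUpTo n)

  Decides : List Form → Form → Set
  Decides Γ f = Γ ⊢ f ⊎ f ∷ Γ ⊢ ψ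

  Decides-mono : Γ ⊆ Δ → Decides Γ χ → Decides Δ χ
  Decides-mono Γ⊆Δ (inj₁ d) = inj₁ (weaken Γ⊆Δ d)
  Decides-mono Γ⊆Δ (inj₂ d) = inj₂ (weaken (∷⁺ʳ _ Γ⊆Δ) d)

  ⊆-extend : ∀ f → Γ ⊆ extend Γ f
  ⊆-extend {Γ} f with lem₀ {f ∷ Γ ⊢ ψ}
  ... | yes _ = ⊆-refl
  ... | no  _ = xs⊆x∷xs Γ f

  ⊆-extendAll : ∀ fs → Γ ⊆ foldl extend Γ fs
  ⊆-extendAll []       = ⊆-refl
  ⊆-extendAll (f ∷ fs) = ⊆-trans (⊆-extend f) (⊆-extendAll fs)

  extend-⊬ψ : ∀ f → ¬ (Γ ⊢ ψ) → ¬ (extend Γ f ⊢ ψ)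
  extend-⊬ψ {Γ} f Γ⊬ψ with lem₀ {f ∷ Γ ⊢ ψ}
  ... | yes _ = Γ⊬ψ
  ... | no  f∷Γ⊬ψ = f∷Γ⊬ψ

  extendAll-⊬ψ : ∀ fs → ¬ (Γ ⊢ ψ) → ¬ (foldl extend Γ fs ⊢ ψ)
  extendAll-⊬ψ []       Γ⊬ψ = Γ⊬ψ
  extendAll-⊬ψ (f ∷ fs) Γ⊬ψ = extendAll-⊬ψ fs (extend-⊬ψ f Γ⊬ψ)

  extend-decides : ∀ f → Decides (extend Γ f) f
  extend-decides {Γ} f with lem₀ {f ∷ Γ ⊢ ψ}
  ... | yes f∷Γ⊢ψ = inj₂ f∷Γ⊢ψ
  ... | no  _     = inj₁ (assumption (here refl))

  extendAll-decides : ∀ {f} fs → f ∈ fs → Decides (foldl extend Γ fs) f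
  extendAll-decides (f ∷ fs) (here refl) = Decides-mono (⊆-extendAll fs) (extend-decides f)
  extendAll-decides (g ∷ fs) (there p)   = extendAll-decides fs p

  stage-mono : n ≤ m → stage n ⊆ stage m
  stage-mono = mono′ ∘ ≤⇒≤′
    where
      mono′ : n ≤′ m → stage n ⊆ stage m
      mono′ ≤′-refl            = ⊆-refl
      mono′ (≤′-step {m} n≤′m) = ⊆-trans (mono′ n≤′m) (⊆-extendAll (formulasUpTo m))

  stage-⊬ψ : ∀ n → ¬ (stage n ⊢ ψ)
  stage-⊬ψ zero    = φ⊬ψ
  stage-⊬ψ (suc n) = extendAll-⊬ψ (formulasUpTo n) (stage-⊬ψ n)

  eventually-decides : ∀ f → Σ ℕ λ N → ∀ {m} → N ≤ m → Decides (stage m) f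
  eventually-decides f with enumerate f
  ... | n , p = suc n , λ le →
    Decides-mono (stage-mono le) (extendAll-decides (formulasUpTo n) p)

  Derivable : Pred Form 0ℓ
  Derivable χ = Σ ℕ λ n → stage n ⊢ χ

  prime-at : ∀ N {a b} → stage N ⊢ a ∨' b → Decides (stage N) a → Decides (stage N) b →
             Derivable a ⊎ Derivable b
  prime-at N _     (inj₁ ⊢a)  _          = inj₁ (N , ⊢a)
  prime-at N _     (inj₂ _)   (inj₁ ⊢b)  = inj₂ (N , ⊢b)
  prime-at N ⊢a∨b (inj₂ a⊢ψ) (inj₂ b⊢ψ) = ⊥-elim (stage-⊬ψ N (∨-elim ⊢a∨b a⊢ψ b⊢ψ))

  Derivable-prime : ∀ {a b} → Derivable (a ∨' b) → Derivable a ⊎ Derivable b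
  Derivable-prime {a} {b} (n , ⊢a∨b) with eventually-decides a | eventually-decides b
  ... | Na , decA | Nb , decB =
    prime-at (n ⊔ (Na ⊔ Nb)) (weaken (stage-mono (m≤m⊔n n _)) ⊢a∨b)
      (decA (≤-trans (m≤m⊔n Na Nb) (m≤n⊔m n _)))
      (decB (≤-trans (m≤n⊔m Na Nb) (m≤n⊔m n _)))

  Derivable-mp : ∀ {a b} → Derivable (a ⇒ b) → Derivable a → Derivable b
  Derivable-mp (n , ⊢a⇒b) (m , ⊢a) =
    n ⊔ m , ⇒-elim (weaken (stage-mono (m≤m⊔n n m)) ⊢a⇒b) (weaken (stage-mono (m≤n⊔m n m)) ⊢a)

  extension : PrimeTheory x
  extension = record
    { mem        = Derivable
    ; has-L      = λ t → zero , axiom t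
    ; closed-mp  = Derivable-mp
    ; consistent = λ (n , ⊢⊥) → stage-⊬ψ n (⇒-elim (axiom ax-⊥E) ⊢⊥)
    ; prime      = Derivable-prime
    }

  extension-⊇T : T ⊆ᵖ mem extension
  extension-⊇T t = zero , premise t

  φ∈extension : mem extension φ
  φ∈extension = zero , assumption (here refl)

  ψ∉extension : ¬ mem extension ψ
  ψ∉extension (n , ⊢ψ) = stage-⊬ψ n ⊢ψ

module _ {x : Op} (w : PrimeTheory x) where

  mem-∧ : mem w (φ ∧' ψ) ⇔ (mem w φ × mem w ψ)
  mem-∧ = mk⇔ (λ φ∧ψ → closed-mp w (has-L w ax-∧E₁) φ∧ψ , closed-mp w (has-L w ax-∧E₂) φ∧ψ)
              (λ (φ∈w , ψ∈w) → closed-mp w (closed-mp w (has-L w ax-∧I) φ∈w) ψ∈w)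

  mem-∨ : mem w (φ ∨' ψ) ⇔ (mem w φ ⊎ mem w ψ)
  mem-∨ = mk⇔ (prime w) [ closed-mp w (has-L w ax-∨I₁) , closed-mp w (has-L w ax-∨I₂) ]

  mem-T : mem w (M φ) → mem w φ
  mem-T = closed-mp w (has-L w ax-T)

Σ≐-⇔ : {A : Set₁} {S : Form → Pred A 0ℓ} {Q : Form → Set} {X : Pred A (lsuc 0ℓ)} →
       (∀ {φ ψ} → S φ ≐ S ψ → Q φ → Q ψ) →
       X ≐ S φ → (Σ Form λ ψ → X ≐ S ψ × Q ψ) ⇔ Q φ
Σ≐-⇔ Q-resp X≐Sφ =
  mk⇔ (λ (ψ , X≐Sψ , Qψ) → Q-resp (≐-trans (≐-sym X≐Sψ) X≐Sφ) Qψ) (λ Qφ → _ , X≐Sφ , Qφ)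

module CanonicalModel (lem : ExcludedMiddle (lsuc 0ℓ)) where

  lem₀ : ExcludedMiddle 0ℓ
  lem₀ = map′ lower lift lem

  dne : DoubleNegationElimination 0ℓ
  dne = em⇒dne lem₀

  module _ {x : Op} where
    open Derivation x

    ¬⇒-witness : (w : PrimeTheory x) → ¬ mem w (φ ⇒ ψ) →
                 Σ (PrimeTheory x) λ z → mem w ⊆ᵖ mem z × mem z φ × ¬ mem z ψ
    ¬⇒-witness {φ} {ψ} w φ⇒ψ∉w = extension , extension-⊇T , φ∈extension , ψ∉extension
      where
        open PrimeExtension lem₀ x (mem w) φ ψ
               (φ⇒ψ∉w ∘ ⊢-closed (mem w) (has-L w) (closed-mp w) ∘ ⇒-intro (mem w))

    hat⊆⇒Thm : hat φ ⊆ᵖ hat {x} ψ → Thm x (φ ⇒ ψ)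
    hat⊆⇒Thm {φ} {ψ} φ̂⊆ψ̂ = dne λ φ⇒ψ∉L →
      let open PrimeExtension lem₀ x (Thm x) φ ψ
                 (φ⇒ψ∉L ∘ ⊢-closed (Thm x) id mp ∘ ⇒-intro (Thm x))
      in ψ∉extension (φ̂⊆ψ̂ {extension} φ∈extension)

    M-resp-hat : (w : PrimeTheory x) → hat φ ≐ hat {x} ψ → mem w (M φ) → mem w (M ψ)
    M-resp-hat {φ} {ψ} w (φ̂⊆ψ̂ , ψ̂⊆φ̂) = closed-mp w (has-L w (mp ax-∧E₁ (cong-M φ⇔ψ)))
      where
        φ⇔ψ : Thm x (φ ⇔' ψ)
        φ⇔ψ = mp (mp ax-∧I (hat⊆⇒Thm (λ {z} → φ̂⊆ψ̂ {z}))) (hat⊆⇒Thm (λ {z} → ψ̂⊆φ̂ {z}))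

    cohat≐⇒hat≐ : cohat φ ≐ cohat {x} ψ → hat φ ≐ hat ψ
    cohat≐⇒hat≐ (φ̌⊆ψ̌ , ψ̌⊆φ̌) =
      (λ {z} φ∈z → dne λ ψ∉z → ψ̌⊆φ̌ {z} ψ∉z φ∈z) , (λ {z} ψ∈z → dne λ φ∉z → φ̌⊆ψ̌ {z} φ∉z ψ∈z)

    T-×-⇔ : {A B : Set₁} (w : PrimeTheory x) →
            A ⇔ mem w φ → B ⇔ mem w (M φ) → (A × B) ⇔ mem w (M φ)
    T-×-⇔ w A⇔φ B⇔Mφ = mk⇔ (to B⇔Mφ ∘ proj₂) (λ Mφ → from A⇔φ (mem-T w Mφ) , from B⇔Mφ Mφ)

    T-×¬-⇔ : {A B : Set₁} (w : PrimeTheory x) →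
             A ⇔ mem w φ → B ⇔ (¬ mem w (M φ)) → (A × ¬ B) ⇔ mem w (M φ)
    T-×¬-⇔ w A⇔φ B⇔¬Mφ =
      mk⇔ (λ (_ , ¬B) → dne (¬B ∘ from B⇔¬Mφ))
          (λ Mφ → from A⇔φ (mem-T w Mφ) , λ B → to B⇔¬Mφ B Mφ)

    ¬M-resp-hat : (w : PrimeTheory x) → hat φ ≐ hat {x} ψ → ¬ mem w (M φ) → ¬ mem w (M ψ)
    ¬M-resp-hat w φ̂≐ψ̂ Mφ∉w = Mφ∉w ∘ M-resp-hat w (≐-sym φ̂≐ψ̂)

    -≐cohat : {X : Pred (PrimeTheory x) (lsuc 0ℓ)} → X ≐ hat φ → (- X) ≐ cohat φ
    -≐cohat (X⊆φ̂ , φ̂⊆X) = (λ {z} z∉X φ∈z → z∉X (φ̂⊆X φ∈z)) , (λ {z} φ∉z z∈X → φ∉z (X⊆φ̂ z∈X))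

  Forces : (x : Op) → PrimeTheory x → Form → Set₁
  Forces x = Forcing._⊩_ x (canonical x)

  ⊩≐hat : {x : Op} → (∀ z → Forces x z φ ⇔ mem z φ) → (λ z → Forces x z φ) ≐ hat φ
  ⊩≐hat ih = (λ {z} → to (ih z)) , (λ {z} → from (ih z))

  truth-M : (x : Op) (w : PrimeTheory x) →
            (∀ z → Forces x z φ ⇔ mem z φ) → Forces x w (M φ) ⇔ mem w (M φ)
  truth-M box    w ih =
    T-×-⇔  w (ih w) (Σ≐-⇔ {S = hat}   (M-resp-hat w) (⊩≐hat ih))
  truth-M dia    w ih =
    T-×¬-⇔ w (ih w) (Σ≐-⇔ {S = cohat} (¬M-resp-hat w ∘ cohat≐⇒hat≐) (-≐cohat (⊩≐hat ih)))
  truth-M bbox   w ih =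
    T-×-⇔  w (ih w) (Σ≐-⇔ {S = cohat} (M-resp-hat w ∘ cohat≐⇒hat≐) (-≐cohat (⊩≐hat ih)))
  truth-M bullet w ih =
    T-×¬-⇔ w (ih w) (Σ≐-⇔ {S = hat}   (¬M-resp-hat w) (⊩≐hat ih))

  truth-⇒ : (x : Op) (w : PrimeTheory x) →
            (∀ z → Forces x z φ ⇔ mem z φ) → (∀ z → Forces x z ψ ⇔ mem z ψ) →
            Forces x w (φ ⇒ ψ) ⇔ mem w (φ ⇒ ψ)
  truth-⇒ {φ} {ψ} x w ihφ ihψ = mk⇔ forced⇒mem mem⇒forced
    where
      forced⇒mem : Forces x w (φ ⇒ ψ) → mem w (φ ⇒ ψ)
      forced⇒mem w⊩φ⇒ψ = dne λ φ⇒ψ∉w →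
        let z , w⊆z , φ∈z , ψ∉z = ¬⇒-witness w φ⇒ψ∉w
        in [ (λ z⊮φ → z⊮φ (from (ihφ z) φ∈z)) , (λ z⊩ψ → ψ∉z (to (ihψ z) z⊩ψ)) ]
             (w⊩φ⇒ψ z (lift w⊆z))

      mem⇒forced : mem w (φ ⇒ ψ) → Forces x w (φ ⇒ ψ)
      mem⇒forced φ⇒ψ∈w z (lift w⊆z) with lem {Forces x z φ}
      ... | yes z⊩φ = inj₂ (from (ihψ z) (closed-mp z (w⊆z φ⇒ψ∈w) (to (ihφ z) z⊩φ)))
      ... | no  z⊮φ = inj₁ z⊮φ

  truth : (x : Op) (γ : Form) (w : PrimeTheory x) → Forces x w γ ⇔ mem w γ
  truth x (var q)  w = mk⇔ lower lift
  truth x ⊥'       w = mk⇔ (⊥-elim ∘ lower) (⊥-elim ∘ consistent w)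
  truth x (φ ∧' ψ) w = ⇔-sym (mem-∧ w) ⇔-∘ (truth x φ w ×-⇔ truth x ψ w)
  truth x (φ ∨' ψ) w = ⇔-sym (mem-∨ w) ⇔-∘ (truth x φ w ⊎-⇔ truth x ψ w)
  truth x (φ ⇒ ψ)  w = truth-⇒ x w (truth x φ) (truth x ψ)
  truth x (M φ)    w = truth-M x w (truth x φ)

mainTheorem15 : ExcludedMiddle (lsuc 0ℓ) →
    (x : Op) (γ : Form) (w : PrimeTheory x) →
    Forcing._⊩_ x (canonical x) w γ ⇔ mem w γ
mainTheorem15 lem = CanonicalModel.truth lem
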